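{- Let $n\ge 2$. The ternary relations $\mathcal T(\overline{\mathcal K}_n)$ and $\mathcal T(D_n)$ are isomorphic. Consequently, under the induced identification of coordinates, $P(\overline{\mathcal K}_n)=P(D_n)$.
   Context: A (symmetric) ternary relation is a pair $\mathcal T=(\Sigma,R)$ where $\Sigma$ is a finite set and $R$ is a set of unordered triples $[i,j,k]$ of elements of $\Sigma$. Two ternary relations $(\Sigma_1,R_1)$, $(\Sigma_2,R_2)$ are isomorphic if there is a bijection $\phi:\Sigma_1\to\Sigma_2$ such that $[i,j,k]\in R_1$ iff $[\phi(i),\phi(j),\phi(k)]\in R_2$. The ternary polytope is $P(\mathcal T)=\mathrm{Conv}\{\mathbf 1_i+\mathbf 1_j-\mathbf 1_k,\ \mathbf 1_i-\mathbf 1_j+\mathbf 1_k,\ -\mathbf 1_i+\mathbf 1_j+\mathbf 1_k : [i,j,k]\in R\}\subset\mathbb R^{\Sigma}$. For a finite configuration $\Omega=\{\pm\alpha_1,\dots,\pm\alpha_m\}\subset\mathbb R^d$ with $\Omega=-\Omega$, $\mathcal T(\Omega)=(\{1,\dots,m\},R_\Omega)$ where $R_\Omega$ is the set of triples $[i,j,k]$ with $\pm\alpha_i\pm\alpha_j\pm\alpha_k=0$ for some choice of signs; $P(\Omega):=P(\mathcal T(\Omega))$. The root system $D_n$ is $\{\pm(\varepsilon_i-\varepsilon_j),\pm(\varepsilon_i+\varepsilon_j):1\le i<j\le n\}\subset\mathbb R^n$. A simplicial poset is a poset with unique minimum $\hat 0$ in which every interval $[\hat0,x]$ is isomorphic to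 a Boolean lattice; its elements of dimension $0,1,2$ (i.e. with $[\hat0,x]$ the Boolean lattice on $1,2,3$ elements) are vertices, edges, triangles. For a $2$-dimensional simplicial poset $\mathcal P$, $\mathcal T(\mathcal P)=(\mathcal P(1),R_{\mathcal P})$ with $\mathcal P(1)$ the set of edges and $R_{\mathcal P}$ the set of triples $[e_1,e_2,e_3]$ such that $e_1,e_2,e_3$ are the three edge facets of some triangle; $P(\mathcal P):=P(\mathcal T(\mathcal P))$. The simplicial poset $\overline{\mathcal K}_n$: it has a minimum $\hat 0$; vertices $v_1,\dots,v_n$; edges $e_{ij}=e_{ji}$ and $e^i_j=e^j_i$ for each pair $i\ne j$, both having vertex faces $v_i,v_j$; triangles $\Delta_{ijk}$ (one for each $3$-element subset $\{i,j,k\}$) with edge facets $e_{ij},e_{jk},e_{ik}$, and triangles $\Delta^i_{jk}=\Delta^i_{kj}$ (for pairwise distinct $i,j,k$) with edge facets $e^i_j,e^i_k,e_{jk}$; the vertex faces of $\Delta_{ijk}$ and $\Delta^i_{jk}$ are $v_i,v_j,v_k$. The order is generated by these face relations.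
   Formalization: The polytopes $P(\overline{\mathcal K}_n)$ and $P(D_n)$ are taken as sets of points with rational coordinates, formed with rational convex weights, rather than as subsets of $\mathbb R^{\Sigma}$. -}

module Defs where

open import Data.Nat using (ℕ)
open import Data.Fin using (Fin; _<_)
open import Data.Fin.Properties using (<-cmp; <-trans) renaming (_≟_ to _≟F_)
open import Data.Integer as ℤ using (ℤ; 0ℤ; 1ℤ; -_)
open import Data.Rational as ℚ using (ℚ; 0ℚ; 1ℚ)
open import Data.Bool using (Bool; true; false; if_then_else_)
open import Data.List using (List; []; _∷_; foldr)
open import Data.List.Relation.Unary.All using (All)
open import Data.List.Relation.Binary.Permutation.Propositional using (_↭_)
open import Data.Product using (Σ; ∃; _×_; _,_; proj₁; proj₂)
open import Data.Empty using (⊥-elim)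
open import Function.Bundles using (_↔_; _⇔_; Inverse)
open import Relation.Binary using (tri<; tri≈; tri>)
open import Relation.Binary.Definitions using (DecidableEquality)
open import Relation.Binary.PropositionalEquality using (_≡_; _≢_; refl)
open import Relation.Nullary using (yes; no; does)

-- Ternary relations (Σ , R).  R is a set of *unordered* triples; we
-- encode it as a predicate on ordered triples which, in every
-- construction below, is invariant under permuting its arguments.

record TernaryRelation : Set₁ where
  field
    Carrier : Set
    _≟_     : DecidableEquality Carrier
    R       : Carrier → Carrier → Carrier → Set

open TernaryRelation public

record _≅ᵀ_ (T₁ T₂ : TernaryRelation) : Set₁ where
  field
    φ    : Carrier T₁ ↔ Carrier T₂
    pres : ∀ i j k →
           R T₁ i j k ⇔ R T₂ (Inverse.to φ i) (Inverse.to φ j) (Inverse.to φ k)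

open _≅ᵀ_ public

module _ (T : TernaryRelation) where
  private
    C = Carrier T

  𝟙 : C → C → ℚ
  𝟙 i c = if does ((_≟_ T) i c) then 1ℚ else 0ℚ

  gen : C → C → C → C → ℚ
  gen i j k c = (𝟙 i c ℚ.+ 𝟙 j c) ℚ.- 𝟙 k c

  -- generating points: {1_i+1_j-1_k, 1_i-1_j+1_k, -1_i+1_j+1_k : [i,j,k] ∈ R}
  -- (R is symmetric, so ranging over ordered triples covers all three)
  IsGenerator : (C → ℚ) → Set
  IsGenerator p = ∃ λ i → ∃ λ j → ∃ λ k → R T i j k × (∀ c → p c ≡ gen i j k c)

  InPolytope : (C → ℚ) → Set
  InPolytope x =
    ∃ λ (L : List (ℚ × (C → ℚ))) →
      All (λ wp → (0ℚ ℚ.≤ proj₁ wp) × IsGenerator (proj₂ wp)) L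
      × (foldr (λ wp acc → proj₁ wp ℚ.+ acc) 0ℚ L ≡ 1ℚ)
      × (∀ c → x c ≡ foldr (λ wp acc → (proj₁ wp ℚ.* proj₂ wp c) ℚ.+ acc) 0ℚ L)

data Sign : Set where
  pos neg : Sign

_·_ : Sign → ℤ → ℤ
pos · z = z
neg · z = - z

T-Ω : {d : ℕ} (I : Set) → DecidableEquality I → (I → Fin d → ℤ) → TernaryRelation
T-Ω {d} I dec α = record
  { Carrier = I
  ; _≟_ = dec
  ; R = λ a b c → ∃ λ s₁ → ∃ λ s₂ → ∃ λ s₃ →
          ∀ (t : Fin d) → (s₁ · α a t) ℤ.+ (s₂ · α b t) ℤ.+ (s₃ · α c t) ≡ 0ℤ
  }

-- Unordered pairs {i,j} ⊆ Fin n, stored as i < j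

data Pair (n : ℕ) : Set where
  pr : (i j : Fin n) → .(i < j) → Pair n

_≟P_ : ∀ {n} → DecidableEquality (Pair n)
pr i j _ ≟P pr k l _ with i ≟F k | j ≟F l
... | yes refl | yes refl = yes refl
... | no ¬p    | _        = no λ { refl → ¬p refl }
... | yes _    | no ¬q    = no λ { refl → ¬q refl }

mkPair : ∀ {n} (i j : Fin n) → i ≢ j → Pair n
mkPair i j i≢j with <-cmp i j
... | tri< p _ _ = pr i j p
... | tri≈ _ e _ = ⊥-elim (i≢j e)
... | tri> _ _ p = pr j i p

-- The root system D_n: positive representatives α, one for each ±pair
--   ε_i - ε_j  and  ε_i + ε_j   (i < j)

data DRoot (n : ℕ) : Set where
  minus plus : Pair n → DRoot n

_≟D_ : ∀ {n} → DecidableEquality (DRoot n)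
minus p ≟D minus q with p ≟P q
... | yes refl = yes refl
... | no ¬e = no λ { refl → ¬e refl }
plus p ≟D plus q with p ≟P q
... | yes refl = yes refl
... | no ¬e = no λ { refl → ¬e refl }
minus _ ≟D plus _ = no λ ()
plus _ ≟D minus _ = no λ ()

ε : ∀ {n} → Fin n → Fin n → ℤ
ε i t = if does (i ≟F t) then 1ℤ else 0ℤ

αD : ∀ {n} → DRoot n → Fin n → ℤ
αD (minus (pr i j _)) t = ε i t ℤ.- ε j t
αD (plus  (pr i j _)) t = ε i t ℤ.+ ε j t

T-D : ℕ → TernaryRelation
T-D n = T-Ω (DRoot n) _≟D_ αD

P-D : (n : ℕ) → (DRoot n → ℚ) → Set
P-D n = InPolytope (T-D n)

-- 2-dimensional simplicial posets, presented by their faces of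
-- dimension 0,1,2 and the face maps (the order is generated by these).

record SimplicialPoset2 : Set₁ where
  field
    Vertex    : Set
    Edge      : Set
    Triangle  : Set
    _≟E_      : DecidableEquality Edge
    edgeVerts : Edge → List Vertex
    triFacets : Triangle → List Edge
    triVerts  : Triangle → List Vertex

open SimplicialPoset2 public

T-P : SimplicialPoset2 → TernaryRelation
T-P 𝒫 = record
  { Carrier = Edge 𝒫
  ; _≟_ = _≟E_ 𝒫
  ; R = λ e₁ e₂ e₃ → ∃ λ (t : Triangle 𝒫) → triFacets 𝒫 t ↭ (e₁ ∷ e₂ ∷ e₃ ∷ [])
  }

data KEdge (n : ℕ) : Set where
  e eᵘ : Pair n → KEdge n

_≟K_ : ∀ {n} → DecidableEquality (KEdge n)
e p ≟K e q with p ≟P q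
... | yes refl = yes refl
... | no ¬e = no λ { refl → ¬e refl }
eᵘ p ≟K eᵘ q with p ≟P q
... | yes refl = yes refl
... | no ¬e = no λ { refl → ¬e refl }
e _ ≟K eᵘ _ = no λ ()
eᵘ _ ≟K e _ = no λ ()

-- triangles: Δ_{ijk} for each 3-subset (stored i<j<k), and
-- Δ^i_{jk} = Δ^i_{kj} for pairwise distinct i,j,k (stored j<k)
data KTri (n : ℕ) : Set where
  Δ  : (i j k : Fin n) → .(i < j) → .(j < k) → KTri n
  Δᵘ : (i j k : Fin n) → .(j < k) → i ≢ j → i ≢ k → KTri n

pairVerts : ∀ {n} → Pair n → List (Fin n)
pairVerts (pr i j _) = i ∷ j ∷ []

KEdgeVerts : ∀ {n} → KEdge n → List (Fin n)
KEdgeVerts (e p)  = pairVerts p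
KEdgeVerts (eᵘ p) = pairVerts p

KTriFacets : ∀ {n} → KTri n → List (KEdge n)
KTriFacets (Δ i j k p q) =
  e (pr i j p) ∷ e (pr j k q) ∷ e (pr i k (<-trans p q)) ∷ []
KTriFacets (Δᵘ i j k p a b) =
  eᵘ (mkPair i j a) ∷ eᵘ (mkPair i k b) ∷ e (pr j k p) ∷ []

KTriVerts : ∀ {n} → KTri n → List (Fin n)
KTriVerts (Δ i j k _ _)    = i ∷ j ∷ k ∷ []
KTriVerts (Δᵘ i j k _ _ _) = i ∷ j ∷ k ∷ []

K̄ : ℕ → SimplicialPoset2
K̄ n = record
  { Vertex = Fin n ; Edge = KEdge n ; Triangle = KTri n ; _≟E_ = _≟K_
  ; edgeVerts = KEdgeVerts ; triFacets = KTriFacets ; triVerts = KTriVerts }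

T-K̄ : ℕ → TernaryRelation
T-K̄ n = T-P (K̄ n)

P-K̄ : (n : ℕ) → (KEdge n → ℚ) → Set
P-K̄ n = InPolytope (T-K̄ n)

-- The bijection is e_{ij} ↦ ε_i − ε_j, e^i_j ↦ ε_i + ε_j.  Each triangle of K̄_n is sent to a
-- triple of roots with a signed sum zero.  Conversely, if ±α_a ± α_b ± α_c = 0 then in every
-- coordinate the entries lie in {0, ±1} and cancel, so each coordinate lies in the support of none
-- or exactly two of the roots; three 2-element supports with this property are the sides of a
-- triangle u v w.  Cancellation at u, v, w forces the product of the types of the roots (− for
-- ε_i − ε_j, + for ε_i + ε_j) to be −, i.e. an even number of them are of the form ε_i + ε_j:
-- these are exactly the shapes Δ_{ijk} and Δ^i_{jk}.  An isomorphism of ternary relations maps the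
-- generating points of one polytope onto those of the other, so the polytopes correspond.

module Submission where

open import Defs
open import Data.Nat using (ℕ; _≤_)
open import Function.Bundles using (_⇔_; Inverse)
open import Function.Base using (_∘_)
open import Data.Product using (Σ)
open import Data.Rational using (ℚ)

open import Data.Empty using (⊥-elim)
open import Data.Fin using (Fin; _<_)
open import Data.Fin.Properties using (<-cmp; <-asym; <⇒≢; _<?_) renaming (_≟_ to _≟F_)
open import Data.Integer as ℤ using (ℤ; 0ℤ; 1ℤ; -1ℤ; -_)
import Data.Integer.Properties as ℤ
open import Algebra.Properties.CommutativeSemigroup ℤ.+-commutativeSemigroup
  using (xy∙z≈yx∙z; xy∙z≈xz∙y)
open import Data.Integer.Tactic.RingSolver using (solve-∀)
open import Data.List using ([]; _∷_; map)
open import Data.List.Properties using (foldr-map)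
open import Data.List.Relation.Unary.All as All using ()
open import Data.List.Relation.Unary.All.Properties using (map⁺)
open import Data.List.Relation.Unary.Any using (here; there)
open import Data.List.Relation.Binary.Permutation.Propositional
  using (_↭_; prep; swap; ↭-refl; ↭-sym; ↭-trans)
open import Data.List.Relation.Binary.Permutation.Propositional.Properties
  using (∈-resp-↭; drop-∷; ↭-singleton-inv) renaming (map⁺ to ↭-map⁺)
open import Data.Maybe as Maybe using (Maybe; just; nothing)
open import Data.Product using (∃; _×_; _,_; map₂)
open import Data.Sum using (_⊎_; inj₁; inj₂; [_,_])
open import Function.Bundles using (Equivalence; mk⇔; mk↔ₛ′)
open import Function.Properties.Inverse using (↔-sym)
open import Relation.Binary using (tri<; tri≈; tri>)
open import Relation.Binary.Definitions using (DecidableEquality)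
open import Relation.Binary.PropositionalEquality
  using (_≡_; _≢_; refl; sym; trans; cong; cong₂; subst; module ≡-Reasoning)
open import Relation.Nullary using (¬_; Dec; yes; no; _⊎-dec_)
open import Relation.Nullary.Decidable using (recompute)

open ≡-Reasoning

-- Transport of polytopes along isomorphisms

R-cong : ∀ T {i i′ j j′ k k′} → i ≡ i′ → j ≡ j′ → k ≡ k′ → R T i j k → R T i′ j′ k′
R-cong T refl refl refl r = r

≅ᵀ-sym : ∀ {T₁ T₂} → T₁ ≅ᵀ T₂ → T₂ ≅ᵀ T₁
≅ᵀ-sym {T₂ = T₂} iso = record
  { φ    = ↔-sym (φ iso)
  ; pres = λ i j k →
      let module P = Equivalence (pres iso (from i) (from j) (from k)) in mk⇔
      (P.from ∘ R-cong T₂ (sym (to∘from i)) (sym (to∘from j)) (sym (to∘from k)))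
      (R-cong T₂ (to∘from i) (to∘from j) (to∘from k) ∘ P.to)
  }
  where
  open Inverse (φ iso)

  to∘from : ∀ i → to (from i) ≡ i
  to∘from = strictlyInverseˡ

module _ {T₁ T₂ : TernaryRelation} (iso : T₁ ≅ᵀ T₂) where
  open Inverse (φ iso)

  𝟙-transport : ∀ i c → 𝟙 T₂ (to i) c ≡ 𝟙 T₁ i (from c)
  𝟙-transport i c with (_≟_ T₂) (to i) c | (_≟_ T₁) i (from c)
  ... | yes _      | yes _        = refl
  ... | no  _      | no  _        = refl
  ... | yes to-i≡c | no  i≢from-c = ⊥-elim (i≢from-c (sym (inverseʳ (sym to-i≡c))))
  ... | no  to-i≢c | yes i≡from-c = ⊥-elim (to-i≢c (inverseˡ i≡from-c))

  gen-transport : ∀ i j k c → gen T₂ (to i) (to j) (to k) c ≡ gen T₁ i j k (from c)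
  gen-transport i j k c rewrite 𝟙-transport i c | 𝟙-transport j c | 𝟙-transport k c = refl

  IsGenerator-transport : ∀ {p} → IsGenerator T₁ p → IsGenerator T₂ (p ∘ from)
  IsGenerator-transport (i , j , k , r , p≗gen) =
    to i , to j , to k , Equivalence.to (pres iso i j k) r ,
    λ c → trans (p≗gen (from c)) (sym (gen-transport i j k c))

  InPolytope-transport : ∀ {x} → InPolytope T₁ x → InPolytope T₂ (x ∘ from)
  InPolytope-transport (L , generators , weights , coordinates) =
    map (map₂ (_∘ from)) L ,
    map⁺ (All.map (map₂ IsGenerator-transport) generators) ,
    trans (foldr-map _ _ _ L) weights ,
    λ c → trans (coordinates (from c)) (sym (foldr-map _ _ _ L))

InPolytope-resp : ∀ T {x y} → (∀ c → x c ≡ y c) → InPolytope T x → InPolytope T y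
InPolytope-resp T x≗y (L , generators , weights , coordinates) =
  L , generators , weights , λ c → trans (sym (x≗y c)) (coordinates c)

≅ᵀ⇒InPolytope⇔ : ∀ {T₁ T₂} (iso : T₁ ≅ᵀ T₂) (x : Carrier T₁ → ℚ) →
                 InPolytope T₁ x ⇔ InPolytope T₂ (x ∘ Inverse.from (φ iso))
≅ᵀ⇒InPolytope⇔ {T₁} iso x = mk⇔
  (InPolytope-transport iso)
  (InPolytope-resp T₁ (cong x ∘ strictlyInverseʳ) ∘ InPolytope-transport (≅ᵀ-sym iso))
  where open Inverse (φ iso)

module _ {A : Set} (P : A → A → A → Set)
         (swap₁₂ : ∀ a b c → P a b c → P b a c)
         (swap₂₃ : ∀ a b c → P a b c → P a c b) where

  private
    resp-↭₂ : ∀ {a b c y z} → P a b c → b ∷ c ∷ [] ↭ y ∷ z ∷ [] → P a y z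
    resp-↭₂ {b = b} {c} r ρ with ∈-resp-↭ (↭-sym ρ) (here refl)
    ... | here refl
          with refl ← ↭-singleton-inv (↭-sym (drop-∷ ρ)) = r
    ... | there (here refl)
          with refl ← ↭-singleton-inv (↭-sym (drop-∷ (↭-trans (swap c b ↭-refl) ρ))) =
            swap₂₃ _ _ _ r

  resp-↭₃ : ∀ {a b c x y z} → P a b c → a ∷ b ∷ c ∷ [] ↭ x ∷ y ∷ z ∷ [] → P x y z
  resp-↭₃ {a} {b} {c} r ρ with ∈-resp-↭ (↭-sym ρ) (here refl)
  ... | here refl = resp-↭₂ r (drop-∷ ρ)
  ... | there (here refl) = resp-↭₂ (swap₁₂ _ _ _ r) (drop-∷ (↭-trans (swap b a ↭-refl) ρ))
  ... | there (there (here refl)) =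
        resp-↭₂ (swap₁₂ _ _ _ (swap₂₃ _ _ _ r))
                (drop-∷ (↭-trans (↭-trans (swap c a ↭-refl) (prep a (swap c b ↭-refl))) ρ))

module _ {d : ℕ} (I : Set) (_≟I_ : DecidableEquality I) (α : I → Fin d → ℤ) where

  T-Ω-swap₁₂ : ∀ a b c → R (T-Ω I _≟I_ α) a b c → R (T-Ω I _≟I_ α) b a c
  T-Ω-swap₁₂ _ b _ (s₁ , s₂ , s₃ , sum≡0) =
    s₂ , s₁ , s₃ , λ t → trans (xy∙z≈yx∙z (s₂ · α b t) _ _) (sum≡0 t)

  T-Ω-swap₂₃ : ∀ a b c → R (T-Ω I _≟I_ α) a b c → R (T-Ω I _≟I_ α) a c b
  T-Ω-swap₂₃ a _ c (s₁ , s₂ , s₃ , sum≡0) =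
    s₁ , s₃ , s₂ , λ t → trans (xy∙z≈xz∙y (s₁ · α a t) (s₃ · α c t) _) (sum≡0 t)

module _ (𝒫 : SimplicialPoset2) {a b c : Edge 𝒫} where

  T-P-swap₁₂ : R (T-P 𝒫) a b c → R (T-P 𝒫) b a c
  T-P-swap₁₂ (t , facets↭) = t , ↭-trans facets↭ (swap a b ↭-refl)

  T-P-swap₂₃ : R (T-P 𝒫) a b c → R (T-P 𝒫) a c b
  T-P-swap₂₃ (t , facets↭) = t , ↭-trans facets↭ (prep a (swap b c ↭-refl))

-- Three pairs covering every point evenly form a triangle

data TwoOrNone (P Q R : Set) : Set where
  none      : ¬ P → ¬ Q → ¬ R → TwoOrNone P Q R
  exactly₁₂ : P → Q → ¬ R → TwoOrNone P Q R
  exactly₁₃ : P → ¬ Q → R → TwoOrNone P Q R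
  exactly₂₃ : ¬ P → Q → R → TwoOrNone P Q R

module _ {P Q R : Set} where

  TwoOrNone-swap₁₂ : TwoOrNone P Q R → TwoOrNone Q P R
  TwoOrNone-swap₁₂ (none ¬p ¬q ¬r)      = none ¬q ¬p ¬r
  TwoOrNone-swap₁₂ (exactly₁₂ p q ¬r)   = exactly₁₂ q p ¬r
  TwoOrNone-swap₁₂ (exactly₁₃ p ¬q r)   = exactly₂₃ ¬q p r
  TwoOrNone-swap₁₂ (exactly₂₃ ¬p q r)   = exactly₁₃ q ¬p r

  TwoOrNone-swap₂₃ : TwoOrNone P Q R → TwoOrNone P R Q
  TwoOrNone-swap₂₃ (none ¬p ¬q ¬r)      = none ¬p ¬r ¬q
  TwoOrNone-swap₂₃ (exactly₁₂ p q ¬r)   = exactly₁₃ p ¬r q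
  TwoOrNone-swap₂₃ (exactly₁₃ p ¬q r)   = exactly₁₂ p r ¬q
  TwoOrNone-swap₂₃ (exactly₂₃ ¬p q r)   = exactly₂₃ ¬p r q

  TwoOrNone-third : TwoOrNone P Q R → P → ¬ Q → R
  TwoOrNone-third (none ¬p _ _)      p _  = ⊥-elim (¬p p)
  TwoOrNone-third (exactly₁₂ _ q _)  _ ¬q = ⊥-elim (¬q q)
  TwoOrNone-third (exactly₁₃ _ _ r)  _ _  = r
  TwoOrNone-third (exactly₂₃ ¬p _ _) p _  = ⊥-elim (¬p p)

TwoOrNone-diag : ∀ {P R} → TwoOrNone P P R → ¬ R
TwoOrNone-diag (none _ _ ¬r)       = ¬r
TwoOrNone-diag (exactly₁₂ _ _ ¬r)  = ¬r
TwoOrNone-diag (exactly₁₃ p ¬p _)  = ⊥-elim (¬p p)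
TwoOrNone-diag (exactly₂₃ ¬p p _)  = ⊥-elim (¬p p)

module _ {n : ℕ} where

  infix 4 _∈ₚ_ _∈ₚ?_

  _∈ₚ_ : Fin n → Pair n → Set
  t ∈ₚ pr i j _ = i ≡ t ⊎ j ≡ t

  _∈ₚ?_ : (t : Fin n) (P : Pair n) → Dec (t ∈ₚ P)
  t ∈ₚ? pr i j _ = (i ≟F t) ⊎-dec (j ≟F t)

  pr-≢ : {i j : Fin n} → .(i < j) → i ≢ j
  pr-≢ {i} {j} i<j = <⇒≢ (recompute (i <? j) i<j)

  endpoints : ∀ P → ∃ λ a₁ → ∃ λ a₂ → a₁ ≢ a₂ × a₁ ∈ₚ P × a₂ ∈ₚ P
  endpoints (pr i j i<j) = i , j , pr-≢ i<j , inj₁ refl , inj₂ refl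

  partner : ∀ {P t} → t ∈ₚ P → ∃ λ t′ → t ≢ t′ × t′ ∈ₚ P
  partner {pr i j i<j} (inj₁ refl) = j , pr-≢ i<j , inj₂ refl
  partner {pr i j i<j} (inj₂ refl) = i , pr-≢ i<j ∘ sym , inj₁ refl

  ∈ₚ⇒≡⊎≡ : ∀ {P u v t} → u ≢ v → u ∈ₚ P → v ∈ₚ P → t ∈ₚ P → t ≡ u ⊎ t ≡ v
  ∈ₚ⇒≡⊎≡ {pr _ _ _} _   (inj₁ refl) _           (inj₁ refl) = inj₁ refl
  ∈ₚ⇒≡⊎≡ {pr _ _ _} _   (inj₂ refl) _           (inj₂ refl) = inj₁ refl
  ∈ₚ⇒≡⊎≡ {pr _ _ _} _   (inj₁ refl) (inj₂ refl) (inj₂ refl) = inj₂ refl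
  ∈ₚ⇒≡⊎≡ {pr _ _ _} _   (inj₂ refl) (inj₁ refl) (inj₁ refl) = inj₂ refl
  ∈ₚ⇒≡⊎≡ {pr _ _ _} u≢v (inj₁ refl) (inj₁ refl) _           = ⊥-elim (u≢v refl)
  ∈ₚ⇒≡⊎≡ {pr _ _ _} u≢v (inj₂ refl) (inj₂ refl) _           = ⊥-elim (u≢v refl)

  Pair-≡ : ∀ {P Q u v} → u ≢ v → u ∈ₚ P → v ∈ₚ P → u ∈ₚ Q → v ∈ₚ Q → P ≡ Q
  Pair-≡ {pr _ _ _} {pr _ _ _} _ (inj₁ refl) (inj₂ refl) (inj₁ refl) (inj₂ refl) = refl
  Pair-≡ {pr _ _ _} {pr _ _ _} _ (inj₂ refl) (inj₁ refl) (inj₂ refl) (inj₁ refl) = refl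
  Pair-≡ {pr i j i<j} {pr _ _ j<i} _ (inj₁ refl) (inj₂ refl) (inj₂ refl) (inj₁ refl) =
    ⊥-elim (<-asym (recompute (i <? j) i<j) (recompute (j <? i) j<i))
  Pair-≡ {pr i j i<j} {pr _ _ j<i} _ (inj₂ refl) (inj₁ refl) (inj₁ refl) (inj₂ refl) =
    ⊥-elim (<-asym (recompute (i <? j) i<j) (recompute (j <? i) j<i))
  Pair-≡ {pr _ _ _} u≢v (inj₁ refl) (inj₁ refl) _ _ = ⊥-elim (u≢v refl)
  Pair-≡ {pr _ _ _} u≢v (inj₂ refl) (inj₂ refl) _ _ = ⊥-elim (u≢v refl)
  Pair-≡ {pr _ _ _} {pr _ _ _} u≢v _ _ (inj₁ refl) (inj₁ refl) = ⊥-elim (u≢v refl)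
  Pair-≡ {pr _ _ _} {pr _ _ _} u≢v _ _ (inj₂ refl) (inj₂ refl) = ⊥-elim (u≢v refl)

  pr-≡ : ∀ {i j P} .(i<j : i < j) → i ∈ₚ P → j ∈ₚ P → pr i j i<j ≡ P
  pr-≡ i<j = Pair-≡ (pr-≢ i<j) (inj₁ refl) (inj₂ refl)

  mkPair-∈ˡ : ∀ i j (i≢j : i ≢ j) → i ∈ₚ mkPair i j i≢j
  mkPair-∈ˡ i j i≢j with <-cmp i j
  ... | tri< _ _ _   = inj₁ refl
  ... | tri≈ _ i≡j _ = ⊥-elim (i≢j i≡j)
  ... | tri> _ _ _   = inj₂ refl

  mkPair-∈ʳ : ∀ i j (i≢j : i ≢ j) → j ∈ₚ mkPair i j i≢j
  mkPair-∈ʳ i j i≢j with <-cmp i j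
  ... | tri< _ _ _   = inj₂ refl
  ... | tri≈ _ i≡j _ = ⊥-elim (i≢j i≡j)
  ... | tri> _ _ _   = inj₁ refl

  mkPair-≡ : ∀ {i j P} (i≢j : i ≢ j) → i ∈ₚ P → j ∈ₚ P → mkPair i j i≢j ≡ P
  mkPair-≡ {i} {j} i≢j = Pair-≡ i≢j (mkPair-∈ˡ i j i≢j) (mkPair-∈ʳ i j i≢j)

  record Sides (u v w : Fin n) (A B C : Pair n) : Set where
    field
      u≢v : u ≢ v
      v≢w : v ≢ w
      u≢w : u ≢ w
      u∈A : u ∈ₚ A
      v∈A : v ∈ₚ A
      v∈B : v ∈ₚ B
      w∈B : w ∈ₚ B
      u∈C : u ∈ₚ C
      w∈C : w ∈ₚ C

    u∉B : ¬ u ∈ₚ B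
    u∉B u∈B = [ u≢v , u≢w ] (∈ₚ⇒≡⊎≡ v≢w v∈B w∈B u∈B)

    v∉C : ¬ v ∈ₚ C
    v∉C v∈C = [ u≢v ∘ sym , v≢w ] (∈ₚ⇒≡⊎≡ u≢w u∈C w∈C v∈C)

    w∉A : ¬ w ∈ₚ A
    w∉A w∈A = [ u≢w ∘ sym , v≢w ∘ sym ] (∈ₚ⇒≡⊎≡ u≢v u∈A v∈A w∈A)

  Sides-rotate : ∀ {u v w A B C} → Sides u v w A B C → Sides v w u B C A
  Sides-rotate s = record
    { u≢v = v≢w ; v≢w = u≢w ∘ sym ; u≢w = u≢v ∘ sym
    ; u∈A = v∈B ; v∈A = w∈B ; v∈B = w∈C ; w∈B = u∈C ; u∈C = v∈A ; w∈C = u∈A }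
    where open Sides s

  Sides-swap : ∀ {u v w A B C} → Sides u v w A B C → Sides v u w A C B
  Sides-swap s = record
    { u≢v = u≢v ∘ sym ; v≢w = u≢w ; u≢w = v≢w
    ; u∈A = v∈A ; v∈A = u∈A ; v∈B = u∈C ; w∈B = w∈C ; u∈C = v∈B ; w∈C = w∈B }
    where open Sides s

  IsTriangle : Pair n → Pair n → Pair n → Set
  IsTriangle A B C = ∃ λ u → ∃ λ v → ∃ λ w → Sides u v w A B C

  EvenCover : Pair n → Pair n → Pair n → Set
  EvenCover A B C = ∀ t → TwoOrNone (t ∈ₚ A) (t ∈ₚ B) (t ∈ₚ C)

  module _ {A B C : Pair n} (cover : EvenCover A B C) where

    EvenCover⇒IsTriangle-through : ∀ {a₁ a₂} → a₁ ≢ a₂ → a₁ ∈ₚ A → a₂ ∈ₚ A → a₁ ∈ₚ B →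
                                   IsTriangle A B C
    EvenCover⇒IsTriangle-through {a₁} {a₂} a₁≢a₂ a₁∈A a₂∈A a₁∈B with partner a₁∈B
    ... | b , a₁≢b , b∈B with b ≟F a₂
    ...   | yes refl =
            let A≡B = Pair-≡ a₁≢a₂ a₁∈A a₂∈A a₁∈B b∈B
                c , _ , _ , c∈C , _ = endpoints C
            in ⊥-elim (TwoOrNone-diag (subst (λ X → TwoOrNone (c ∈ₚ X) _ _) A≡B (cover c)) c∈C)
    ...   | no b≢a₂ = a₂ , a₁ , b , record
            { u≢v = a₁≢a₂ ∘ sym ; v≢w = a₁≢b ; u≢w = b≢a₂ ∘ sym
            ; u∈A = a₂∈A ; v∈A = a₁∈A ; v∈B = a₁∈B ; w∈B = b∈B ; u∈C = a₂∈C ; w∈C = b∈C }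
      where
      b∉A : ¬ b ∈ₚ A
      b∉A b∈A = [ a₁≢b ∘ sym , b≢a₂ ] (∈ₚ⇒≡⊎≡ a₁≢a₂ a₁∈A a₂∈A b∈A)

      b∈C : b ∈ₚ C
      b∈C = TwoOrNone-third (TwoOrNone-swap₁₂ (cover b)) b∈B b∉A

      a₂∉B : ¬ a₂ ∈ₚ B
      a₂∉B a₂∈B = [ a₁≢a₂ ∘ sym , b≢a₂ ∘ sym ] (∈ₚ⇒≡⊎≡ a₁≢b a₁∈B b∈B a₂∈B)

      a₂∈C : a₂ ∈ₚ C
      a₂∈C = TwoOrNone-third (cover a₂) a₂∈A a₂∉B

  EvenCover⇒IsTriangle : ∀ {A B C} → EvenCover A B C → IsTriangle A B C
  EvenCover⇒IsTriangle {A} {B} cover with endpoints A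
  ... | a₁ , a₂ , a₁≢a₂ , a₁∈A , a₂∈A with a₁ ∈ₚ? B
  ...   | yes a₁∈B = EvenCover⇒IsTriangle-through cover a₁≢a₂ a₁∈A a₂∈A a₁∈B
  ...   | no  a₁∉B with EvenCover⇒IsTriangle-through (TwoOrNone-swap₂₃ ∘ cover) a₁≢a₂ a₁∈A a₂∈A
                          (TwoOrNone-third (cover a₁) a₁∈A a₁∉B)
  ...     | u , v , w , sides = v , u , w , Sides-swap sides

infixl 7 _⊗_

_⊗_ : Sign → Sign → Sign
pos ⊗ s   = s
neg ⊗ pos = neg
neg ⊗ neg = pos

[s⊗x]⊗[s⊗y]≡x⊗y : ∀ s x y → (s ⊗ x) ⊗ (s ⊗ y) ≡ x ⊗ y
[s⊗x]⊗[s⊗y]≡x⊗y pos _   _   = refl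
[s⊗x]⊗[s⊗y]≡x⊗y neg pos pos = refl
[s⊗x]⊗[s⊗y]≡x⊗y neg pos neg = refl
[s⊗x]⊗[s⊗y]≡x⊗y neg neg pos = refl
[s⊗x]⊗[s⊗y]≡x⊗y neg neg neg = refl

triangle-sign : ∀ x y z → x ⊗ y ⊗ (neg ⊗ y ⊗ z) ⊗ (neg ⊗ x ⊗ (neg ⊗ z)) ≡ neg
triangle-sign pos pos pos = refl
triangle-sign pos pos neg = refl
triangle-sign pos neg pos = refl
triangle-sign pos neg neg = refl
triangle-sign neg pos pos = refl
triangle-sign neg pos neg = refl
triangle-sign neg neg pos = refl
triangle-sign neg neg neg = refl

⟦_⟧ : Sign → ℤ
⟦ pos ⟧ = 1ℤ
⟦ neg ⟧ = -1ℤ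

⟪_⟫ : Maybe Sign → ℤ
⟪ nothing ⟫ = 0ℤ
⟪ just σ ⟫  = ⟦ σ ⟧

_⊙_ : Sign → Maybe Sign → Maybe Sign
s ⊙ x = Maybe.map (s ⊗_) x

·-⟪⟫ : ∀ s x → s · ⟪ x ⟫ ≡ ⟪ s ⊙ x ⟫
·-⟪⟫ pos nothing    = refl
·-⟪⟫ pos (just _)   = refl
·-⟪⟫ neg nothing    = refl
·-⟪⟫ neg (just pos) = refl
·-⟪⟫ neg (just neg) = refl

data ZeroSum : Maybe Sign → Maybe Sign → Maybe Sign → Set where
  zeros : ZeroSum nothing nothing nothing
  opp₁₂ : ∀ σ → ZeroSum (just σ) (just (neg ⊗ σ)) nothing
  opp₁₃ : ∀ σ → ZeroSum (just σ) nothing (just (neg ⊗ σ))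
  opp₂₃ : ∀ σ → ZeroSum nothing (just σ) (just (neg ⊗ σ))

zeroSum : ∀ x y z → ⟪ x ⟫ ℤ.+ ⟪ y ⟫ ℤ.+ ⟪ z ⟫ ≡ 0ℤ → ZeroSum x y z
zeroSum nothing    nothing    nothing    _  = zeros
zeroSum (just pos) (just neg) nothing    _  = opp₁₂ pos
zeroSum (just neg) (just pos) nothing    _  = opp₁₂ neg
zeroSum (just pos) nothing    (just neg) _  = opp₁₃ pos
zeroSum (just neg) nothing    (just pos) _  = opp₁₃ neg
zeroSum nothing    (just pos) (just neg) _  = opp₂₃ pos
zeroSum nothing    (just neg) (just pos) _  = opp₂₃ neg
zeroSum nothing    nothing    (just pos) ()
zeroSum nothing    nothing    (just neg) ()
zeroSum nothing    (just pos) nothing    ()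
zeroSum nothing    (just neg) nothing    ()
zeroSum nothing    (just pos) (just pos) ()
zeroSum nothing    (just neg) (just neg) ()
zeroSum (just pos) nothing    nothing    ()
zeroSum (just neg) nothing    nothing    ()
zeroSum (just pos) nothing    (just pos) ()
zeroSum (just neg) nothing    (just neg) ()
zeroSum (just pos) (just pos) nothing    ()
zeroSum (just neg) (just neg) nothing    ()
zeroSum (just pos) (just pos) (just pos) ()
zeroSum (just pos) (just pos) (just neg) ()
zeroSum (just pos) (just neg) (just pos) ()
zeroSum (just pos) (just neg) (just neg) ()
zeroSum (just neg) (just pos) (just pos) ()
zeroSum (just neg) (just pos) (just neg) ()
zeroSum (just neg) (just neg) (just pos) ()
zeroSum (just neg) (just neg) (just neg) ()

ZeroSum-opp₁₂ : ∀ {x y} → ZeroSum (just x) (just y) nothing → y ≡ neg ⊗ x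
ZeroSum-opp₁₂ (opp₁₂ _) = refl

ZeroSum-opp₁₃ : ∀ {x z} → ZeroSum (just x) nothing (just z) → z ≡ neg ⊗ x
ZeroSum-opp₁₃ (opp₁₃ _) = refl

ZeroSum-opp₂₃ : ∀ {y z} → ZeroSum nothing (just y) (just z) → z ≡ neg ⊗ y
ZeroSum-opp₂₃ (opp₂₃ _) = refl

-- Triples of D_n roots with a vanishing signed sum

module _ {n : ℕ} where

  pair : DRoot n → Pair n
  pair (minus P) = P
  pair (plus P)  = P

  sgn : DRoot n → Sign
  sgn (minus _) = neg
  sgn (plus _)  = pos

  coef : ∀ r {t} → t ∈ₚ pair r → Sign
  coef (minus (pr _ _ _)) (inj₁ _) = pos
  coef (minus (pr _ _ _)) (inj₂ _) = neg
  coef (plus _)           _        = pos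

  coef-⊗ : ∀ r {u v} → u ≢ v → (u∈r : u ∈ₚ pair r) (v∈r : v ∈ₚ pair r) →
           coef r u∈r ⊗ coef r v∈r ≡ sgn r
  coef-⊗ (plus _)           _   _           _           = refl
  coef-⊗ (minus (pr _ _ _)) _   (inj₁ _)    (inj₂ _)    = refl
  coef-⊗ (minus (pr _ _ _)) _   (inj₂ _)    (inj₁ _)    = refl
  coef-⊗ (minus (pr _ _ _)) u≢v (inj₁ refl) (inj₁ refl) = ⊥-elim (u≢v refl)
  coef-⊗ (minus (pr _ _ _)) u≢v (inj₂ refl) (inj₂ refl) = ⊥-elim (u≢v refl)

  ε-self : (i : Fin n) → ε i i ≡ 1ℤ
  ε-self i with i ≟F i
  ... | yes _   = refl
  ... | no  i≢i = ⊥-elim (i≢i refl)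

  ε-other : {i t : Fin n} → i ≢ t → ε i t ≡ 0ℤ
  ε-other {i} {t} i≢t with i ≟F t
  ... | yes i≡t = ⊥-elim (i≢t i≡t)
  ... | no  _   = refl

  αD-∈ : ∀ r {t} (t∈r : t ∈ₚ pair r) → αD r t ≡ ⟦ coef r t∈r ⟧
  αD-∈ (minus (pr i j i<j)) (inj₁ refl) rewrite ε-self i | ε-other (pr-≢ i<j ∘ sym) = refl
  αD-∈ (minus (pr i j i<j)) (inj₂ refl) rewrite ε-self j | ε-other (pr-≢ i<j)       = refl
  αD-∈ (plus  (pr i j i<j)) (inj₁ refl) rewrite ε-self i | ε-other (pr-≢ i<j ∘ sym) = refl
  αD-∈ (plus  (pr i j i<j)) (inj₂ refl) rewrite ε-self j | ε-other (pr-≢ i<j)       = refl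

  αD-∉ : ∀ r {t} → ¬ t ∈ₚ pair r → αD r t ≡ 0ℤ
  αD-∉ (minus (pr _ _ _)) t∉r rewrite ε-other (t∉r ∘ inj₁) | ε-other (t∉r ∘ inj₂) = refl
  αD-∉ (plus  (pr _ _ _)) t∉r rewrite ε-other (t∉r ∘ inj₁) | ε-other (t∉r ∘ inj₂) = refl

  αD-plus-mkPair : ∀ (i j : Fin n) (i≢j : i ≢ j) t → αD (plus (mkPair i j i≢j)) t ≡ ε i t ℤ.+ ε j t
  αD-plus-mkPair i j i≢j t with <-cmp i j
  ... | tri< _ _ _   = refl
  ... | tri≈ _ i≡j _ = ⊥-elim (i≢j i≡j)
  ... | tri> _ _ _   = ℤ.+-comm (ε j t) (ε i t)

  module _ {a b c : DRoot n} {s₁ s₂ s₃ : Sign}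
           (sum≡0 : ∀ t → s₁ · αD a t ℤ.+ s₂ · αD b t ℤ.+ s₃ · αD c t ≡ 0ℤ) where

    private
      entry : ∀ r {t} → Dec (t ∈ₚ pair r) → Maybe Sign
      entry r (yes t∈r) = just (coef r t∈r)
      entry r (no _)    = nothing

      signed-entry : ∀ s r {t} (t∈r? : Dec (t ∈ₚ pair r)) → s · αD r t ≡ ⟪ s ⊙ entry r t∈r? ⟫
      signed-entry s r (yes t∈r) = trans (cong (s ·_) (αD-∈ r t∈r)) (·-⟪⟫ s (just (coef r t∈r)))
      signed-entry s r (no t∉r)  = trans (cong (s ·_) (αD-∉ r t∉r)) (·-⟪⟫ s nothing)

      zeroSum-at : ∀ t (a? : Dec (t ∈ₚ pair a)) (b? : Dec (t ∈ₚ pair b)) (c? : Dec (t ∈ₚ pair c)) →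
                   ZeroSum (s₁ ⊙ entry a a?) (s₂ ⊙ entry b b?) (s₃ ⊙ entry c c?)
      zeroSum-at t a? b? c? = zeroSum _ _ _ (begin
        ⟪ s₁ ⊙ entry a a? ⟫ ℤ.+ ⟪ s₂ ⊙ entry b b? ⟫ ℤ.+ ⟪ s₃ ⊙ entry c c? ⟫
          ≡⟨ sym (cong₂ ℤ._+_ (cong₂ ℤ._+_ (signed-entry s₁ a a?) (signed-entry s₂ b b?))
                               (signed-entry s₃ c c?)) ⟩
        s₁ · αD a t ℤ.+ s₂ · αD b t ℤ.+ s₃ · αD c t
          ≡⟨ sum≡0 t ⟩
        0ℤ ∎)

      twoOrNone : ∀ {t} (a? : Dec (t ∈ₚ pair a)) (b? : Dec (t ∈ₚ pair b)) (c? : Dec (t ∈ₚ pair c)) →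
                  ZeroSum (s₁ ⊙ entry a a?) (s₂ ⊙ entry b b?) (s₃ ⊙ entry c c?) →
                  TwoOrNone (t ∈ₚ pair a) (t ∈ₚ pair b) (t ∈ₚ pair c)
      twoOrNone (no  ¬p) (no  ¬q) (no  ¬r) _ = none ¬p ¬q ¬r
      twoOrNone (yes p)  (yes q)  (no  ¬r) _ = exactly₁₂ p q ¬r
      twoOrNone (yes p)  (no  ¬q) (yes r)  _ = exactly₁₃ p ¬q r
      twoOrNone (no  ¬p) (yes q)  (yes r)  _ = exactly₂₃ ¬p q r
      twoOrNone (yes _)  (yes _)  (yes _)  ()
      twoOrNone (yes _)  (no  _)  (no  _)  ()
      twoOrNone (no  _)  (yes _)  (no  _)  ()
      twoOrNone (no  _)  (no  _)  (yes _)  ()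

    zero-sum⇒EvenCover : EvenCover (pair a) (pair b) (pair c)
    zero-sum⇒EvenCover t = twoOrNone a? b? c? (zeroSum-at t a? b? c?)
      where
      a? : Dec (t ∈ₚ pair a)
      a? = t ∈ₚ? pair a
      b? : Dec (t ∈ₚ pair b)
      b? = t ∈ₚ? pair b
      c? : Dec (t ∈ₚ pair c)
      c? = t ∈ₚ? pair c

    zero-sum⇒sgn : ∀ {u v w} → Sides u v w (pair a) (pair b) (pair c) → sgn a ⊗ sgn b ⊗ sgn c ≡ neg
    zero-sum⇒sgn {u} {v} {w} sides = begin
      sgn a ⊗ sgn b ⊗ sgn c                          ≡⟨ cong₂ _⊗_ (cong₂ _⊗_ sgn-a sgn-b) sgn-c ⟩
      x ⊗ y ⊗ (neg ⊗ y ⊗ z) ⊗ (neg ⊗ x ⊗ (neg ⊗ z))  ≡⟨ triangle-sign x y z ⟩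
      neg                                            ∎
      where
      open Sides sides

      x y z : Sign
      x = s₁ ⊗ coef a u∈A
      y = s₁ ⊗ coef a v∈A
      z = s₂ ⊗ coef b w∈B

      sgn-signed : ∀ s r {p q} → p ≢ q → (p∈r : p ∈ₚ pair r) (q∈r : q ∈ₚ pair r) →
                   sgn r ≡ (s ⊗ coef r p∈r) ⊗ (s ⊗ coef r q∈r)
      sgn-signed s r p≢q p∈r q∈r =
        sym (trans ([s⊗x]⊗[s⊗y]≡x⊗y s _ _) (coef-⊗ r p≢q p∈r q∈r))

      sgn-a : sgn a ≡ x ⊗ y
      sgn-a = sgn-signed s₁ a u≢v u∈A v∈A

      sgn-b : sgn b ≡ neg ⊗ y ⊗ z
      sgn-b = trans (sgn-signed s₂ b v≢w v∈B w∈B)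
        (cong (_⊗ z) (ZeroSum-opp₁₂ (zeroSum-at v (yes v∈A) (yes v∈B) (no v∉C))))

      sgn-c : sgn c ≡ neg ⊗ x ⊗ (neg ⊗ z)
      sgn-c = trans (sgn-signed s₃ c u≢w u∈C w∈C)
        (cong₂ _⊗_ (ZeroSum-opp₁₃ (zeroSum-at u (yes u∈A) (no u∉B) (yes u∈C)))
                   (ZeroSum-opp₂₃ (zeroSum-at w (no w∉A) (yes w∈B) (yes w∈C))))

  T-D⇒Sides : ∀ {a b c} → R (T-D n) a b c →
              ∃ λ u → ∃ λ v → ∃ λ w →
                Sides u v w (pair a) (pair b) (pair c) × sgn a ⊗ sgn b ⊗ sgn c ≡ neg
  T-D⇒Sides {a} {b} {c} (s₁ , s₂ , s₃ , sum≡0)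
    with EvenCover⇒IsTriangle (zero-sum⇒EvenCover {a} {b} {c} {s₁} {s₂} {s₃} sum≡0)
  ... | u , v , w , sides = u , v , w , sides , zero-sum⇒sgn {a} {b} {c} {s₁} {s₂} {s₃} sum≡0 sides

  -- The isomorphism T(K̄_n) ≅ T(D_n)

  toD : KEdge n → DRoot n
  toD (e P)  = minus P
  toD (eᵘ P) = plus P

  fromD : DRoot n → KEdge n
  fromD (minus P) = e P
  fromD (plus P)  = eᵘ P

  private
    RK : KEdge n → KEdge n → KEdge n → Set
    RK = R (T-K̄ n)

    RD : KEdge n → KEdge n → KEdge n → Set
    RD x y z = R (T-D n) (toD x) (toD y) (toD z)

    T-D-resp-↭ : ∀ {a b c x y z} →
                 R (T-D n) a b c → a ∷ b ∷ c ∷ [] ↭ x ∷ y ∷ z ∷ [] → R (T-D n) x y z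
    T-D-resp-↭ = resp-↭₃ (R (T-D n)) (T-Ω-swap₁₂ _ _≟D_ αD) (T-Ω-swap₂₃ _ _≟D_ αD)

    swap₁₂ : ∀ {x y z} → RK x y z → RK y x z
    swap₁₂ = T-P-swap₁₂ (K̄ n)

    swap₂₃ : ∀ {x y z} → RK x y z → RK x z y
    swap₂₃ = T-P-swap₂₃ (K̄ n)

  lower-sorted : ∀ {u v w A B C} → u < v → v < w → Sides u v w A B C → RK (e A) (e B) (e C)
  lower-sorted u<v v<w sides =
    R-cong (T-K̄ n) (cong e (pr-≡ _ u∈A v∈A)) (cong e (pr-≡ _ v∈B w∈B)) (cong e (pr-≡ _ u∈C w∈C))
      (Δ _ _ _ u<v v<w , ↭-refl)
    where open Sides sides

  lower-triangle : ∀ {u v w A B C} → Sides u v w A B C → RK (e A) (e B) (e C)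
  lower-triangle {u} {v} {w} s with <-cmp u v | <-cmp v w | <-cmp u w
  ... | tri≈ _ u≡v _ | _            | _            = ⊥-elim (Sides.u≢v s u≡v)
  ... | _            | tri≈ _ v≡w _ | _            = ⊥-elim (Sides.v≢w s v≡w)
  ... | _            | _            | tri≈ _ u≡w _ = ⊥-elim (Sides.u≢w s u≡w)
  ... | tri< u<v _ _ | tri< v<w _ _ | _            = lower-sorted u<v v<w s
  ... | tri< _ _ _   | tri> _ _ w<v | tri< u<w _ _ =
        swap₁₂ (swap₂₃ (swap₁₂ (lower-sorted u<w w<v (Sides-swap (Sides-rotate (Sides-rotate s))))))
  ... | tri< u<v _ _ | tri> _ _ _   | tri> _ _ w<u =
        swap₂₃ (swap₁₂ (lower-sorted w<u u<v (Sides-rotate (Sides-rotate s))))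
  ... | tri> _ _ v<u | tri< _ _ _   | tri< u<w _ _ =
        swap₂₃ (lower-sorted v<u u<w (Sides-swap s))
  ... | tri> _ _ _   | tri< v<w _ _ | tri> _ _ w<u =
        swap₁₂ (swap₂₃ (lower-sorted v<w w<u (Sides-rotate s)))
  ... | tri> _ _ v<u | tri> _ _ w<v | _            =
        swap₁₂ (lower-sorted w<v v<u (Sides-swap (Sides-rotate s)))

  upper-sorted : ∀ {u v w A B C} → u < v → Sides u v w A B C → RK (e A) (eᵘ B) (eᵘ C)
  upper-sorted u<v sides =
    swap₁₂ (swap₂₃ (swap₁₂
      (R-cong (T-K̄ n) (cong eᵘ (mkPair-≡ _ w∈C u∈C)) (cong eᵘ (mkPair-≡ _ w∈B v∈B))
                      (cong e (pr-≡ _ u∈A v∈A))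
        (Δᵘ _ _ _ u<v (u≢w ∘ sym) (v≢w ∘ sym) , ↭-refl))))
    where open Sides sides

  upper-triangle : ∀ {u v w A B C} → Sides u v w A B C → RK (e A) (eᵘ B) (eᵘ C)
  upper-triangle {u} {v} s with <-cmp u v
  ... | tri< u<v _ _ = upper-sorted u<v s
  ... | tri≈ _ u≡v _ = ⊥-elim (Sides.u≢v s u≡v)
  ... | tri> _ _ v<u = swap₂₃ (upper-sorted v<u (Sides-swap s))

  Sides⇒RK : ∀ x y z {u v w} → Sides u v w (pair (toD x)) (pair (toD y)) (pair (toD z)) →
             sgn (toD x) ⊗ sgn (toD y) ⊗ sgn (toD z) ≡ neg → RK x y z
  Sides⇒RK (e _)  (e _)  (e _)  s _ = lower-triangle s
  Sides⇒RK (e _)  (eᵘ _) (eᵘ _) s _ = upper-triangle s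
  Sides⇒RK (eᵘ _) (e _)  (eᵘ _) s _ =
    swap₁₂ (swap₂₃ (upper-triangle (Sides-rotate s)))
  Sides⇒RK (eᵘ _) (eᵘ _) (e _)  s _ =
    swap₂₃ (swap₁₂ (upper-triangle (Sides-rotate (Sides-rotate s))))
  Sides⇒RK (e _)  (e _)  (eᵘ _) _ ()
  Sides⇒RK (e _)  (eᵘ _) (e _)  _ ()
  Sides⇒RK (eᵘ _) (e _)  (e _)  _ ()
  Sides⇒RK (eᵘ _) (eᵘ _) (eᵘ _) _ ()

  RD⇒RK : ∀ x y z → RD x y z → RK x y z
  RD⇒RK x y z r with T-D⇒Sides {toD x} {toD y} {toD z} r
  ... | _ , _ , _ , sides , sgn≡neg = Sides⇒RK x y z sides sgn≡neg

  RK⇒RD : ∀ {x y z} → RK x y z → RD x y z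
  RK⇒RD (Δ i j k _ _ , facets↭) =
    T-D-resp-↭ (pos , pos , neg , λ t → lower-identity (ε i t) (ε j t) (ε k t)) (↭-map⁺ toD facets↭)
    where
    lower-identity : ∀ a b c → (a ℤ.- b) ℤ.+ (b ℤ.- c) ℤ.+ - (a ℤ.- c) ≡ 0ℤ
    lower-identity = solve-∀
  RK⇒RD (Δᵘ i j k _ i≢j i≢k , facets↭) =
    T-D-resp-↭ (pos , neg , neg , λ t →
      trans (cong₂ (λ p q → p ℤ.+ - q ℤ.+ - (ε j t ℤ.- ε k t))
                   (αD-plus-mkPair i j i≢j t) (αD-plus-mkPair i k i≢k t))
            (upper-identity (ε i t) (ε j t) (ε k t)))
      (↭-map⁺ toD facets↭)
    where
    upper-identity : ∀ a b c → (a ℤ.+ b) ℤ.+ - (a ℤ.+ c) ℤ.+ - (b ℤ.- c) ≡ 0ℤ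
    upper-identity = solve-∀

K̄≅D : ∀ n → T-K̄ n ≅ᵀ T-D n
K̄≅D n = record
  { φ    = mk↔ₛ′ toD fromD toD∘fromD fromD∘toD
  ; pres = λ x y z → mk⇔ RK⇒RD (RD⇒RK x y z)
  }
  where
  toD∘fromD : (r : DRoot n) → toD (fromD r) ≡ r
  toD∘fromD (minus _) = refl
  toD∘fromD (plus _)  = refl

  fromD∘toD : (x : KEdge n) → fromD (toD x) ≡ x
  fromD∘toD (e _)  = refl
  fromD∘toD (eᵘ _) = refl

lemma2p4 : (n : ℕ) → 2 ≤ n →
    Σ (T-K̄ n ≅ᵀ T-D n) (λ iso →
      ∀ (x : KEdge n → ℚ) → P-K̄ n x ⇔ P-D n (x ∘ Inverse.from (φ iso)))
lemma2p4 n _ = K̄≅D n , ≅ᵀ⇒InPolytope⇔ (K̄≅D n)
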